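{- Let $H=(\mathcal{V},\mathcal{E})$ be a hypergraph, $k$ a positive integer, and $f':\mathcal{V}\to\{0,1,\dots,k\}$ a conflict-free colouring of $H$. Let $\mathcal{A}$ be a conflict-free set obtained from $f'$, i.e., a set containing, for each $e\in\mathcal{E}$, exactly one node $(e,v,c)$ such that $e$ is CF coloured by $v$ and $f'(v)=c$. Then $\mathcal{A}$ is a maximum independent set of the conflict graph $G_k$ of $H$ (and has size $|\mathcal{E}|$).
   Context: A function $C:\mathcal{V}\to\{0,1,\dots,k\}$ is a conflict-free (CF) colouring of $H$ with $k$ non-zero colours if for every $e\in\mathcal{E}$ there is a non-zero colour $j$ with $|e\cap C^{ -1}(j)|=1$. A hyperedge $e$ is CF coloured by $v\in e$ (under $C$) if $C(v)\neq 0$ and $C(u)\ne C(v)$ for all $u\in e\setminus\{v\}$. The conflict graph $G_k$ has nodes $(e,v,c)$ with $e\in\mathcal{E}$, $v\in e$, $1\le c\le k$, and edge set $E_{vertex}\cup E_{edge}\cup E_{colour}$: $E_{vertex}$ = pairs $(e,v,c),(g,v,d)$ with $c\ne d$; $E_{edge}$ = pairs of distinct nodes $(e,v,c),(e,u,d)$ with the same hyperedge coordinate; $E_{colour}$ = pairs $(e,v,c),(g,u,c)$ with $u\ne v$ and $\{u,v\}\subseteq e$ or $\{u,v\}\subseteq g$. -}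

module Defs where

open import Data.Nat using (ℕ; suc; _≤_)
open import Data.Fin using (Fin; zero; suc; _≟_)
open import Data.Fin.Subset using (Subset; _∈_; _∩_; ∣_∣)
open import Data.Vec using (tabulate)
open import Data.Product using (Σ; ∃; _×_; _,_; proj₁)
open import Data.Sum using (_⊎_)
open import Data.List using (List; length)
open import Data.List.Membership.Propositional renaming (_∈_ to _∈ₗ_)
open import Data.List.Relation.Unary.All using (All)
open import Data.List.Relation.Unary.Unique.Propositional using (Unique)
open import Relation.Nullary using (¬_; does)
open import Relation.Binary.PropositionalEquality using (_≡_; _≢_)
open import Function.Definitions using (Injective)

-- A finite hypergraph: vertices Fin n, hyperedges indexed by Fin m,
-- each hyperedge a subset of the vertices.  (Distinctness of edges is
-- required separately, since ℰ is a set.)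
record Hypergraph : Set where
  field
    n    : ℕ
    m    : ℕ
    edge : Fin m → Subset n

open Hypergraph public

-- colouring with k non-zero colours: colour 0 is `zero`, colours 1..k are `suc j`
Colouring : Hypergraph → ℕ → Set
Colouring H k = Fin (n H) → Fin (suc k)

preimage : ∀ {H k} → Colouring H k → Fin (suc k) → Subset (n H)
preimage C j = tabulate (λ v → does (C v ≟ j))

IsCFColouring : (H : Hypergraph) (k : ℕ) → Colouring H k → Set
IsCFColouring H k C =
  ∀ (e : Fin (m H)) → ∃ λ (j : Fin k) → ∣ edge H e ∩ preimage {H} {k} C (suc j) ∣ ≡ 1

CFColouredBy : (H : Hypergraph) (k : ℕ) → Colouring H k → Fin (m H) → Fin (n H) → Set
CFColouredBy H k C e v =
  v ∈ edge H e × C v ≢ zero × (∀ u → u ∈ edge H e → u ≢ v → C u ≢ C v)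

-- Nodes (e, v, c) of the conflict graph G_k; colour c ∈ {1..k} encoded as
-- `Fin k` (the paper's colour c corresponds to `suc c` in Fin (suc k)).
Node : Hypergraph → ℕ → Set
Node H k = Fin (m H) × Fin (n H) × Fin k

nodeEdge : ∀ {H k} → Node H k → Fin (m H)
nodeEdge (e , _ , _) = e

ValidNode : (H : Hypergraph) (k : ℕ) → Node H k → Set
ValidNode H k (e , v , c) = v ∈ edge H e

EVertex : (H : Hypergraph) (k : ℕ) → Node H k → Node H k → Set
EVertex H k (e , v , c) (g , u , d) = v ≡ u × c ≢ d

EEdge : (H : Hypergraph) (k : ℕ) → Node H k → Node H k → Set
EEdge H k x@(e , v , c) y@(g , u , d) = e ≡ g × x ≢ y

EColour : (H : Hypergraph) (k : ℕ) → Node H k → Node H k → Set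
EColour H k (e , v , c) (g , u , d) =
  c ≡ d × u ≢ v ×
  ((u ∈ edge H e × v ∈ edge H e) ⊎ (u ∈ edge H g × v ∈ edge H g))

Adjacent : (H : Hypergraph) (k : ℕ) → Node H k → Node H k → Set
Adjacent H k x y = EVertex H k x y ⊎ EEdge H k x y ⊎ EColour H k x y

IsIndependent : (H : Hypergraph) (k : ℕ) → List (Node H k) → Set
IsIndependent H k A =
  Unique A × All (ValidNode H k) A ×
  (∀ x y → x ∈ₗ A → y ∈ₗ A → ¬ Adjacent H k x y)

IsMaximumIndependent : (H : Hypergraph) (k : ℕ) → List (Node H k) → Set
IsMaximumIndependent H k A =
  IsIndependent H k A ×
  (∀ B → IsIndependent H k B → length B ≤ length A)

IsCFSetFrom : (H : Hypergraph) (k : ℕ) → Colouring H k → List (Node H k) → Set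
IsCFSetFrom H k C A =
  Unique A ×
  (∀ e v c → (e , v , c) ∈ₗ A → CFColouredBy H k C e v × C v ≡ suc c) ×
  (∀ e → ∃ λ x → x ∈ₗ A × nodeEdge {H} {k} x ≡ e) ×
  (∀ x y → x ∈ₗ A → y ∈ₗ A → nodeEdge {H} {k} x ≡ nodeEdge {H} {k} y → x ≡ y)

module Submission where

-- The whole argument is a counting argument through the map
-- "node (e, v, c) ↦ its hyperedge e":
--   * in an independent set two distinct nodes never share a hyperedge (they
--     would be joined by E_edge), so this map is injective on the set and the
--     set has at most |ℰ| elements;
--   * a CF set contains a node over every hyperedge, so it has at least |ℰ|
--     elements, hence exactly |ℰ|;
--   * a CF set is independent: the E_vertex, E_edge and E_colour conflicts are
--     excluded by C(v) = c, by "exactly one node per hyperedge", and by the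
--     defining property of "e is CF coloured by v", respectively.

open import Defs
open import Data.Nat using (ℕ; _≤_)
open import Data.Nat.Properties using (≤-antisym)
open import Data.Fin using (Fin; zero; suc; _≟_)
open import Data.Fin.Properties using (suc-injective; injective⇒≤)
open import Data.Product using (_×_; _,_; ∃)
open import Data.Product.Properties using (≡-dec)
open import Data.Sum using (inj₁; inj₂)
open import Data.Empty using (⊥-elim)
open import Data.List using (List; length; lookup; _∷_)
open import Data.List.Relation.Unary.All as All using ()
open import Data.List.Relation.Unary.Any using (index)
open import Data.List.Relation.Unary.Any.Properties using (lookup-index)
open import Data.List.Relation.Unary.AllPairs using (_∷_)
open import Data.List.Relation.Unary.Unique.Propositional using (Unique)
open import Data.List.Membership.Propositional using (_∈_)
open import Data.List.Membership.Propositional.Properties using (∈-lookup)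
open import Relation.Binary.PropositionalEquality using (_≡_; refl; sym; trans; cong)
open import Relation.Binary.Definitions using (DecidableEquality)
open import Relation.Nullary using (¬_)
open import Relation.Nullary.Decidable using (decidable-stable)
open import Function.Definitions using (Injective)

module _ {A : Set} where

  lookup-injective : {xs : List A} → Unique xs →
                     ∀ i j → lookup xs i ≡ lookup xs j → i ≡ j
  lookup-injective (_ ∷ _)       zero    zero    _  = refl
  lookup-injective (x∉xs ∷ _)    zero    (suc j) eq = ⊥-elim (All.lookup x∉xs (∈-lookup j) eq)
  lookup-injective (x∉xs ∷ _)    (suc i) zero    eq = ⊥-elim (All.lookup x∉xs (∈-lookup i) (sym eq))
  lookup-injective (_ ∷ unique)  (suc i) (suc j) eq = cong suc (lookup-injective unique i j eq)

  length-≤-if-injectiveOn : {m : ℕ} (f : A → Fin m) {xs : List A} → Unique xs →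
                            (∀ {x y} → x ∈ xs → y ∈ xs → f x ≡ f y → x ≡ y) →
                            length xs ≤ m
  length-≤-if-injectiveOn f {xs} unique injOn = injective⇒≤ f∘lookup-injective
    where
    f∘lookup-injective : Injective _≡_ _≡_ (λ i → f (lookup xs i))
    f∘lookup-injective {i} {j} eq =
      lookup-injective unique i j (injOn (∈-lookup i) (∈-lookup j) eq)

  length-≥-if-surjectiveOn : {m : ℕ} (f : A → Fin m) {xs : List A} →
                             (∀ i → ∃ λ x → x ∈ xs × f x ≡ i) → m ≤ length xs
  length-≥-if-surjectiveOn f {xs} cover = injective⇒≤ position-injective
    where
    position : Fin _ → Fin (length xs)
    position i with cover i
    ... | _ , x∈xs , _ = index x∈xs

    image-at-position : ∀ i → f (lookup xs (position i)) ≡ i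
    image-at-position i with cover i
    ... | _ , x∈xs , fx≡i rewrite sym (lookup-index x∈xs) = fx≡i

    position-injective : Injective _≡_ _≡_ position
    position-injective {i} {j} eq =
      trans (sym (image-at-position i))
            (trans (cong (λ p → f (lookup xs p)) eq) (image-at-position j))

module _ {H : Hypergraph} {k : ℕ} where

  _≟ₙ_ : DecidableEquality (Node H k)
  _≟ₙ_ = ≡-dec _≟_ (≡-dec _≟_ _≟_)

  edgeOf : Node H k → Fin (m H)
  edgeOf = nodeEdge {H} {k}

  independent-edgeInjective : {B : List (Node H k)} → IsIndependent H k B →
    ∀ {x y} → x ∈ B → y ∈ B → edgeOf x ≡ edgeOf y → x ≡ y
  independent-edgeInjective (_ , _ , nonAdjacent) {x} {y} x∈B y∈B sameEdge =
    decidable-stable (x ≟ₙ y)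
      (λ x≢y → nonAdjacent x y x∈B y∈B (inj₂ (inj₁ (sameEdge , x≢y))))

  independent-length-≤ : {B : List (Node H k)} → IsIndependent H k B → length B ≤ m H
  independent-length-≤ indep@(unique , _ , _) =
    length-≤-if-injectiveOn edgeOf unique (independent-edgeInjective indep)

  module _ {C : Colouring H k} {A : List (Node H k)} (cfSet : IsCFSetFrom H k C A) where

    private
      node-property : ∀ {e v c} → (e , v , c) ∈ A → CFColouredBy H k C e v × C v ≡ suc c
      node-property {e} {v} {c} = let (_ , prop , _ , _) = cfSet in prop e v c

      colour : ∀ {e v c} → (e , v , c) ∈ A → C v ≡ suc c
      colour x∈A = let (_ , Cv≡c) = node-property x∈A in Cv≡c

    cfSet-length : length A ≡ m H
    cfSet-length =
      let (unique , _ , cover , onePerEdge) = cfSet in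
      ≤-antisym (length-≤-if-injectiveOn edgeOf unique (onePerEdge _ _))
                (length-≥-if-surjectiveOn edgeOf cover)

    cfSet-nonAdjacent : ∀ x y → x ∈ A → y ∈ A → ¬ Adjacent H k x y
    -- E_vertex: both nodes carry the colour C(v), so c ≡ d.
    cfSet-nonAdjacent _ _ x∈A y∈A (inj₁ (refl , c≢d)) =
      c≢d (suc-injective (trans (sym (colour x∈A)) (colour y∈A)))
    -- E_edge: A has only one node per hyperedge.
    cfSet-nonAdjacent x y x∈A y∈A (inj₂ (inj₁ (sameEdge , x≢y))) =
      let (_ , _ , _ , onePerEdge) = cfSet in x≢y (onePerEdge x y x∈A y∈A sameEdge)
    -- E_colour with u, v ∈ e: u would share the colour of v in e, which v CF colours.
    cfSet-nonAdjacent _ _ x∈A y∈A (inj₂ (inj₂ (refl , u≢v , inj₁ (u∈e , _)))) =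
      let ((_ , _ , v-unique) , _) = node-property x∈A
      in v-unique _ u∈e u≢v (trans (colour y∈A) (sym (colour x∈A)))
    -- E_colour with u, v ∈ g: symmetrically, v would share the colour of u in g.
    cfSet-nonAdjacent _ _ x∈A y∈A (inj₂ (inj₂ (refl , u≢v , inj₂ (_ , v∈g)))) =
      let ((_ , _ , u-unique) , _) = node-property y∈A
      in u-unique _ v∈g (λ v≡u → u≢v (sym v≡u)) (trans (colour x∈A) (sym (colour y∈A)))

    cfSet-independent : IsIndependent H k A
    cfSet-independent =
      let (unique , _ , _ , _) = cfSet in
      unique ,
      All.tabulate (λ { {_ , _ , _} x∈A → let ((v∈e , _ , _) , _) = node-property x∈A in v∈e }) ,
      cfSet-nonAdjacent

lemma2 : (H : Hypergraph) → Injective _≡_ _≡_ (edge H) →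
         (k : ℕ) → 1 ≤ k →
         (f′ : Colouring H k) → IsCFColouring H k f′ →
         (A : List (Node H k)) → IsCFSetFrom H k f′ A →
         IsMaximumIndependent H k A × length A ≡ m H
lemma2 H _ k _ f′ _ A cfSet =
  (cfSet-independent cfSet , maximum) , cfSet-length cfSet
  where
  maximum : ∀ B → IsIndependent H k B → length B ≤ length A
  maximum B indepB rewrite cfSet-length cfSet = independent-length-≤ indepB
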